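{- Let $p$ be a prime, let $r,s\ge0$ be integers, and let $q=p^r$. Then $\mathsf{D}_{p^s}(\mathbb{Z}_q)=p^{r+s}$.
   Context: For a finite commutative ring $A$, a sequence over $A$ is a finite multiset $S=(a_1,\dots,a_\ell)$ of elements of $A$ (order disregarded, repetition allowed); its length $|S|=\ell$ counts multiplicity, and a subsequence is a sub-multiset. For an integer $m\ge1$ set $e_m(S)=\sum_{1\le i_1<\dots<i_m\le \ell}\prod_{j=1}^m a_{i_j}$. $\mathsf{D}_m(A)$ denotes the smallest positive integer $t$ such that every sequence $S$ over $A$ with $|S|\ge t$ contains a subsequence $S'$ with $|S'|\ge m$ and $e_m(S')=0$. $\mathbb{Z}_q$ is the ring of integers modulo $q$. -}

module Defs where

open import Data.Nat using (ℕ; zero; suc; _+_; _*_; _≤_; _<_)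
open import Data.Nat.Divisibility using (_∣_)
open import Data.Fin using (Fin; toℕ)
open import Data.List using (List; []; _∷_; length; map)
open import Data.List.Relation.Binary.Sublist.Propositional using (_⊆_)
open import Data.Product using (Σ; _×_)
open import Relation.Nullary using (¬_)

esym : ℕ → List ℕ → ℕ
esym zero    xs       = 1
esym (suc m) []       = 0
esym (suc m) (x ∷ xs) = x * esym m xs + esym (suc m) xs

-- Z_q is represented by Fin q (residues 0..q-1).  Since the quotient map
-- ℤ → Z_q is a ring hom, e_m(S) = 0 in Z_q iff q divides e_m of the lifts.
ZeroEm : (q m : ℕ) → List (Fin q) → Set
ZeroEm q m S = q ∣ esym m (map toℕ S)

-- S contains a subsequence S' (sub-multiset, here a sublist) with |S'| ≥ m and e_m(S') = 0.
HasZeroSub : (q m : ℕ) → List (Fin q) → Set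
HasZeroSub q m S = Σ (List (Fin q)) λ S' → (S' ⊆ S) × (m ≤ length S') × ZeroEm q m S'

DProp : (q m t : ℕ) → Set
DProp q m t = (S : List (Fin q)) → t ≤ length S → HasZeroSub q m S

IsD : (q m t : ℕ) → Set
IsD q m t = (1 ≤ t) × DProp q m t × ((t' : ℕ) → 1 ≤ t' → t' < t → ¬ DProp q m t')

-- Upper bound, by the polynomial method.  Put M = p^s, K = p^r - 1 and let S have length
-- p^(r+s) = M (K + 1).  For a subsequence T, F(T) = C(e_M(T) + K, K) is ≡ 1 (mod p) when
-- |T| < M and ≡ 0 (mod p) when p^r ∤ e_M(T), because C(x + K, K) mod p only depends on
-- x mod p^r (Vandermonde, and p ∣ C(p^r, i) for 0 < i < p^r).  As a function of the indicator
-- vector of T, F has degree at most M K < |S|, so its alternating sum over all T ⊆ S vanishes,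
-- whereas the alternating sum of [|T| < M] is ±C(|S| - 1, M - 1) ≡ ±1 (mod p).  Hence some T
-- with |T| ≥ M has p^r ∣ e_M(T).
--
-- Lower bound.  On the sequence of p^(r+s) - 1 ones, e_M(T) = C(|T|, M); for
-- p^s ≤ k < p^(r+s) the p-adic valuation of C(k, p^s) is that of ⌊k / p^s⌋ < p^r, so p^r ∤ C(k, p^s).

{-# OPTIONS --safe #-}
module Submission where

open import Defs

open import Data.List using (List; []; _∷_; length; map; replicate; take)
open import Data.List.Properties using (length-replicate; map-replicate; length-take; length-map)
open import Data.List.Relation.Binary.Sublist.Propositional using (_⊆_; []; _∷_; _∷ʳ_; ⊆-trans)
open import Data.List.Relation.Binary.Sublist.Propositional.Properties using (take-⊆; length-mono-≤)
open import Data.Fin as Fin using (Fin; toℕ; fromℕ<)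
open import Data.Fin.Properties using (toℕ-fromℕ<)
open import Data.Empty using (⊥-elim)
open import Data.Product using (∃-syntax; _×_; _,_)
open import Data.Sum using (inj₁; inj₂)
open import Function using (_∘_)
open import Relation.Nullary using (Dec; yes; no; ¬_; contradiction)
open import Relation.Nullary.Decidable using (map′; _⊎-dec_; _×-dec_)
open import Relation.Binary.PropositionalEquality

-- Finite differences and alternating sums over subsequences

module FiniteDifference {A : Set} where

  open import Data.Nat as ℕ using (ℕ; zero; suc; _≤_; z≤n; s≤s)
  open import Data.Nat.Properties as ℕ using ()
  open import Data.Integer using (ℤ; 0ℤ; _+_; _*_; _-_; -_)
  open import Data.Integer.Properties using (+-inverseʳ; +-identityˡ; *-zeroʳ; neg-involutive)
  open import Data.Integer.Tactic.RingSolver using (solve-∀)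
  open import Data.Integer.Divisibility.Signed using (_∣_; ∣m∣n⇒∣m-n; ∣m⇒∣-m)

  Δ : A → (List A → ℤ) → List A → ℤ
  Δ a F T = F (a ∷ T) - F T

  -- F has degree < n as a function of the sub-multiset T: its n-fold differences vanish.
  data DegreeBelow : ℕ → (List A → ℤ) → Set where
    vanishing   : ∀ {F} → (∀ T → F T ≡ 0ℤ) → DegreeBelow zero F
    differences : ∀ {n F} → (∀ a → DegreeBelow n (Δ a F)) → DegreeBelow (suc n) F

  DegreeBelow-cong : ∀ {n F G} → (∀ T → F T ≡ G T) → DegreeBelow n F → DegreeBelow n G
  DegreeBelow-cong F≗G (vanishing F₀) = vanishing (λ T → trans (sym (F≗G T)) (F₀ T))
  DegreeBelow-cong F≗G (differences dF) =
    differences (λ a → DegreeBelow-cong (λ T → cong₂ _-_ (F≗G (a ∷ T)) (F≗G T)) (dF a))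

  DegreeBelow-zero : ∀ n {F} → (∀ T → F T ≡ 0ℤ) → DegreeBelow n F
  DegreeBelow-zero zero    F₀ = vanishing F₀
  DegreeBelow-zero (suc n) F₀ =
    differences (λ a → DegreeBelow-zero n (λ T → cong₂ _-_ (F₀ (a ∷ T)) (F₀ T)))

  DegreeBelow-suc : ∀ {n F} → DegreeBelow n F → DegreeBelow (suc n) F
  DegreeBelow-suc (vanishing F₀)   = DegreeBelow-zero 1 F₀
  DegreeBelow-suc (differences dF) = differences (λ a → DegreeBelow-suc (dF a))

  DegreeBelow-mono : ∀ {m n F} → m ≤ n → DegreeBelow m F → DegreeBelow n F
  DegreeBelow-mono {n = zero}  z≤n dF = dF
  DegreeBelow-mono {n = suc n} z≤n dF = DegreeBelow-suc (DegreeBelow-mono z≤n dF)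
  DegreeBelow-mono (s≤s m≤n) (differences dF) = differences (λ a → DegreeBelow-mono m≤n (dF a))

  DegreeBelow-const : ∀ c → DegreeBelow 1 (λ _ → c)
  DegreeBelow-const c = differences (λ a → vanishing (λ T → +-inverseʳ c))

  DegreeBelow-+ : ∀ {n F G} → DegreeBelow n F → DegreeBelow n G → DegreeBelow n (λ T → F T + G T)
  DegreeBelow-+ (vanishing F₀) (vanishing G₀) = vanishing (λ T → cong₂ _+_ (F₀ T) (G₀ T))
  DegreeBelow-+ {F = F} {G} (differences dF) (differences dG) = differences λ a →
    DegreeBelow-cong (λ T → regroup (F (a ∷ T)) (G (a ∷ T)) (F T) (G T)) (DegreeBelow-+ (dF a) (dG a))
    where
    regroup : ∀ u v x y → (u - x) + (v - y) ≡ (u + v) - (x + y)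
    regroup = solve-∀

  vanishes : ∀ {F} → DegreeBelow zero F → ∀ T → F T ≡ 0ℤ
  vanishes (vanishing F₀) = F₀

  Δ-degree : ∀ {n F} → DegreeBelow (suc n) F → ∀ a → DegreeBelow n (Δ a F)
  Δ-degree (differences dF) = dF

  -- The product rule Δ(FG) = ΔF · (G + ΔG) + F · ΔG, both terms of lower degree.
  DegreeBelow-* : ∀ {m n F G} → DegreeBelow (suc m) F → DegreeBelow (suc n) G →
    DegreeBelow (suc (m ℕ.+ n)) (λ T → F T * G T)
  ΔF*G′ : ∀ {m n F G} → DegreeBelow (suc m) F → DegreeBelow (suc n) G →
    ∀ a → DegreeBelow (m ℕ.+ n) (λ T → Δ a F T * (G T + Δ a G T))
  F*ΔG : ∀ {m n F G} → DegreeBelow (suc m) F → DegreeBelow (suc n) G →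
    ∀ a → DegreeBelow (m ℕ.+ n) (λ T → F T * Δ a G T)

  DegreeBelow-* {F = F} {G} dF dG = differences λ a →
    DegreeBelow-cong (λ T → productRule (F (a ∷ T)) (G (a ∷ T)) (F T) (G T))
      (DegreeBelow-+ (ΔF*G′ dF dG a) (F*ΔG dF dG a))
    where
    productRule : ∀ u v x y → (u - x) * (y + (v - y)) + x * (v - y) ≡ u * v - x * y
    productRule = solve-∀

  ΔF*G′ {zero}  {n} {G = G} dF dG a =
    DegreeBelow-zero n (λ T → cong (_* (G T + Δ a G T)) (vanishes (Δ-degree dF a) T))
  ΔF*G′ {suc m} dF dG a = DegreeBelow-* (Δ-degree dF a) (DegreeBelow-+ dG (DegreeBelow-suc (Δ-degree dG a)))

  F*ΔG {m} {zero}  {F} dF dG a = DegreeBelow-zero (m ℕ.+ 0)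
    (λ T → trans (cong (F T *_) (vanishes (Δ-degree dG a) T)) (*-zeroʳ (F T)))
  F*ΔG {m} {suc n} {F} {G} dF dG a = subst (λ k → DegreeBelow k (λ T → F T * Δ a G T)) (sym (ℕ.+-suc m n))
    (DegreeBelow-* dF (Δ-degree dG a))

  -- Σ_{T ⊆ S} (-1)^|T| F(T), summing over sublists with multiplicity.
  altSum : List A → (List A → ℤ) → ℤ
  altSum []      F = F []
  altSum (a ∷ S) F = altSum S F - altSum S (λ T → F (a ∷ T))

  altSum-0 : ∀ S → altSum S (λ _ → 0ℤ) ≡ 0ℤ
  altSum-0 []      = refl
  altSum-0 (a ∷ S) rewrite altSum-0 S = refl

  altSum-− : ∀ S F G → altSum S (λ T → F T - G T) ≡ altSum S F - altSum S G
  altSum-− []      F G = refl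
  altSum-− (a ∷ S) F G
    rewrite altSum-− S F G | altSum-− S (F ∘ (a ∷_)) (G ∘ (a ∷_)) =
    regroup (altSum S F) (altSum S G) (altSum S (F ∘ (a ∷_))) (altSum S (G ∘ (a ∷_)))
    where
    regroup : ∀ u v x y → (u - v) - (x - y) ≡ (u - x) - (v - y)
    regroup = solve-∀

  altSum-vanish : ∀ S {F} → DegreeBelow (length S) F → altSum S F ≡ 0ℤ
  altSum-vanish []      dF = vanishes dF []
  altSum-vanish (a ∷ S) {F} dF = begin
    altSum S F - altSum S (F ∘ (a ∷_))    ≡⟨ flip (altSum S (F ∘ (a ∷_))) (altSum S F) ⟩
    - (altSum S (F ∘ (a ∷_)) - altSum S F) ≡⟨ cong -_ (altSum-− S (F ∘ (a ∷_)) F) ⟨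
    - altSum S (Δ a F)                     ≡⟨ cong -_ (altSum-vanish S (Δ-degree dF a)) ⟩
    0ℤ                                     ∎
    where
    open ≡-Reasoning
    flip : ∀ x y → y - x ≡ - (x - y)
    flip = solve-∀

  altSum-∣ : ∀ S {d F} → (∀ T → T ⊆ S → d ∣ F T) → d ∣ altSum S F
  altSum-∣ []      d∣F = d∣F [] []
  altSum-∣ (a ∷ S) d∣F =
    ∣m∣n⇒∣m-n (altSum-∣ S (λ T T⊆S → d∣F T (a ∷ʳ T⊆S)))
              (altSum-∣ S (λ T T⊆S → d∣F (a ∷ T) (refl ∷ T⊆S)))

  altSum-∣-low-degree : ∀ S {d F G} → DegreeBelow (length S) F → (∀ T → T ⊆ S → d ∣ F T - G T) →
    d ∣ altSum S G
  altSum-∣-low-degree S {d} {F} {G} dF d∣F-G =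
    subst (d ∣_) (neg-involutive _) (∣m⇒∣-m (subst (d ∣_) ΣF-G≡-ΣG (altSum-∣ S d∣F-G)))
    where
    open ≡-Reasoning
    ΣF-G≡-ΣG : altSum S (λ T → F T - G T) ≡ - altSum S G
    ΣF-G≡-ΣG = begin
      altSum S (λ T → F T - G T)    ≡⟨ altSum-− S F G ⟩
      altSum S F - altSum S G       ≡⟨ cong (_- altSum S G) (altSum-vanish S dF) ⟩
      0ℤ - altSum S G               ≡⟨ +-identityˡ _ ⟩
      - altSum S G                  ∎

sublist-any? : ∀ {A : Set} {P : List A → Set} → (∀ T → Dec (P T)) → ∀ S → Dec (∃[ T ] (T ⊆ S × P T))
sublist-any? P? []      = map′ (λ p → [] , [] , p) (λ { (.[] , [] , p) → p }) (P? [])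
sublist-any? P? (a ∷ S) =
  map′ (λ { (inj₁ (T , T⊆S , p)) → T , a ∷ʳ T⊆S , p
          ; (inj₂ (T , T⊆S , p)) → a ∷ T , refl ∷ T⊆S , p })
       (λ { (T , .a ∷ʳ T⊆S , p)      → inj₁ (T , T⊆S , p)
          ; (.a ∷ T , refl ∷ T⊆S , p) → inj₂ (T , T⊆S , p) })
       (sublist-any? P? S ⊎-dec sublist-any? (P? ∘ (a ∷_)) S)

open FiniteDifference

DegreeBelow-∘map : ∀ {A B : Set} (g : B → A) {n F} → DegreeBelow {A} n F → DegreeBelow {B} n (F ∘ map g)
DegreeBelow-∘map g (vanishing F₀)   = vanishing (F₀ ∘ map g)
DegreeBelow-∘map g (differences dF) = differences (λ b → DegreeBelow-∘map g (dF (g b)))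

open import Data.Nat as ℕ
  using (ℕ; zero; suc; _+_; _*_; _∸_; _^_; _≤_; _<_; _≤?_; z≤n; s≤s; NonZero; nonTrivial⇒n>1)
open import Data.Nat.Properties
open import Data.Nat.Divisibility
open import Data.Nat.DivMod using (_%_; _/_; m≡m%n+[m/n]*n; m%n<n; [m+kn]%n≡m%n; m<n⇒m%n≡m)
open import Data.Nat.Induction using (<-wellFounded)
open import Data.Nat.Primality using (Prime; euclidsLemma; prime⇒nonZero; prime⇒nonTrivial)
open import Data.Nat.Tactic.RingSolver using (solve-∀)
open import Data.Integer as ℤ using (ℤ; +_; 0ℤ; 1ℤ; -1ℤ)
open import Data.Integer.Properties as ℤ using (pos-+; pos-*)
import Data.Integer.Tactic.RingSolver as ℤ
open import Data.Integer.Divisibility.Signed as ℤ using (∣⇒∣ᵤ; ∣ᵤ⇒∣)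
open import Induction.WellFounded using (Acc; acc)

-- Binomial coefficients

-- Pascal's recursion, so that the defining equations hold definitionally
-- (the library's _C_ is defined through factorials).
infixl 7.5 _choose_

_choose_ : ℕ → ℕ → ℕ
n     choose zero  = 1
zero  choose suc k = 0
suc n choose suc k = n choose k + n choose suc k

n<k⇒nCk≡0 : ∀ {n k} → n < k → n choose k ≡ 0
n<k⇒nCk≡0 {zero}  {suc k} _         = refl
n<k⇒nCk≡0 {suc n} {suc k} (s≤s n<k)
  rewrite n<k⇒nCk≡0 n<k | n<k⇒nCk≡0 (m<n⇒m<1+n n<k) = refl

nCn≡1 : ∀ n → n choose n ≡ 1
nCn≡1 zero = refl
nCn≡1 (suc n) rewrite nCn≡1 n | n<k⇒nCk≡0 (n<1+n n) = refl

nC1≡n : ∀ n → n choose 1 ≡ n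
nC1≡n zero    = refl
nC1≡n (suc n) = cong suc (nC1≡n n)

convolve : (ℕ → ℕ) → (ℕ → ℕ) → ℕ → ℕ
convolve f g zero    = f 0 * g 0
convolve f g (suc k) = f 0 * g (suc k) + convolve (f ∘ suc) g k

convolve-distribʳ-+ : ∀ f f′ g k →
  convolve (λ i → f i + f′ i) g k ≡ convolve f g k + convolve f′ g k
convolve-distribʳ-+ f f′ g zero    = *-distribʳ-+ (g 0) (f 0) (f′ 0)
convolve-distribʳ-+ f f′ g (suc k)
  rewrite convolve-distribʳ-+ (f ∘ suc) (f′ ∘ suc) g k =
  lemma (f 0) (f′ 0) (g (suc k)) (convolve (f ∘ suc) g k) (convolve (f′ ∘ suc) g k)
  where
  lemma : ∀ a b c d e → (a + b) * c + (d + e) ≡ a * c + d + (b * c + e)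
  lemma = solve-∀

convolve-zero : ∀ g k → convolve (λ i → 0 choose suc i) g k ≡ 0
convolve-zero g zero    = refl
convolve-zero g (suc k) = convolve-zero g k

vandermonde : ∀ x y k → (x + y) choose k ≡ convolve (x choose_) (y choose_) k
vandermonde zero    y zero    = sym (+-identityʳ _)
vandermonde zero    y (suc k) rewrite convolve-zero (y choose_) k =
  sym (trans (+-identityʳ _) (+-identityʳ _))
vandermonde (suc x) y zero    = refl
vandermonde (suc x) y (suc k) = begin
  (x + y) choose k + (x + y) choose suc k
    ≡⟨ cong₂ _+_ (vandermonde x y k) (vandermonde x y (suc k)) ⟩
  convolve (x choose_) (y choose_) k + (1 * y choose suc k + convolve (λ i → x choose suc i) (y choose_) k)
    ≡⟨ lemma (convolve (x choose_) (y choose_) k) (y choose suc k) _ ⟩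
  1 * y choose suc k + (convolve (x choose_) (y choose_) k + convolve (λ i → x choose suc i) (y choose_) k)
    ≡⟨ cong (λ n → 1 * y choose suc k + n)
            (convolve-distribʳ-+ (x choose_) (λ i → x choose suc i) (y choose_) k) ⟨
  convolve (suc x choose_) (y choose_) (suc k) ∎
  where
  open ≡-Reasoning
  lemma : ∀ a b c → a + (1 * b + c) ≡ 1 * b + (a + c)
  lemma = solve-∀

absorption : ∀ n k → suc k * suc n choose suc k ≡ suc n * n choose k
absorption zero    zero    = refl
absorption zero    (suc k) = *-zeroʳ (suc (suc k))
absorption (suc n) zero    rewrite nC1≡n n = *-comm 1 (suc (suc n))
absorption (suc n) (suc k) = begin
  suc (suc k) * (x + y + b)
    ≡⟨ expand k x y b ⟩
  (x + y) + suc k * (x + y) + suc (suc k) * b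
    ≡⟨ cong₂ (λ u v → (x + y) + u + v) (absorption n k) (absorption n (suc k)) ⟩
  (x + y) + suc n * x + suc n * y
    ≡⟨ collect n x y ⟩
  suc (suc n) * (x + y) ∎
  where
  open ≡-Reasoning
  x = n choose k
  y = n choose suc k
  b = suc n choose suc (suc k)
  expand : ∀ k x y b → suc (suc k) * (x + y + b) ≡ (x + y) + suc k * (x + y) + suc (suc k) * b
  expand = solve-∀
  collect : ∀ n x y → (x + y) + suc n * x + suc n * y ≡ suc (suc n) * (x + y)
  collect = solve-∀

choose-sym : ∀ a b → (a + b) choose a ≡ (a + b) choose b
choose-sym zero    b       = sym (nCn≡1 b)
choose-sym (suc a) zero    rewrite +-identityʳ a = nCn≡1 (suc a)
choose-sym (suc a) (suc b) = begin
  (a + suc b) choose a + (a + suc b) choose suc a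
    ≡⟨ cong₂ _+_ (choose-sym a (suc b)) (trans (cong (_choose suc a) (+-suc a b)) (choose-sym (suc a) b)) ⟩
  (a + suc b) choose suc b + (suc a + b) choose b
    ≡⟨ cong (λ n → (a + suc b) choose suc b + n choose b) (+-suc a b) ⟨
  (a + suc b) choose suc b + (a + suc b) choose b
    ≡⟨ +-comm ((a + suc b) choose suc b) _ ⟩
  (a + suc b) choose b + (a + suc b) choose suc b ∎
  where open ≡-Reasoning

choose-succ-ratio : ∀ m y → suc (m + y) choose m * suc y ≡ (m + y) choose m * suc (m + y)
choose-succ-ratio m y = begin
  suc (m + y) choose m * suc y      ≡⟨ cong (λ n → n choose m * suc y) (+-suc m y) ⟨
  (m + suc y) choose m * suc y      ≡⟨ cong (_* suc y) (choose-sym m (suc y)) ⟩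
  (m + suc y) choose suc y * suc y  ≡⟨ cong (λ n → n choose suc y * suc y) (+-suc m y) ⟩
  suc (m + y) choose suc y * suc y  ≡⟨ *-comm _ (suc y) ⟩
  suc y * suc (m + y) choose suc y  ≡⟨ absorption (m + y) y ⟩
  suc (m + y) * (m + y) choose y    ≡⟨ cong (suc (m + y) *_) (choose-sym m y) ⟨
  suc (m + y) * (m + y) choose m    ≡⟨ *-comm (suc (m + y)) _ ⟩
  (m + y) choose m * suc (m + y)    ∎
  where open ≡-Reasoning

n∣[1+k]*nC[1+k] : ∀ n k → n ∣ suc k * n choose suc k
n∣[1+k]*nC[1+k] zero    k = divides 0 (*-zeroʳ (suc k))
n∣[1+k]*nC[1+k] (suc n) k = divides (n choose k) (trans (absorption n k) (*-comm (suc n) _))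

[M+uM]CM≡[1+u]*[m+uM]Cm : ∀ m u → (suc m + u * suc m) choose suc m ≡ suc u * (m + u * suc m) choose m
[M+uM]CM≡[1+u]*[m+uM]Cm m u = *-cancelˡ-≡ _ _ (suc m) (begin
  suc m * suc n choose suc m    ≡⟨ absorption n m ⟩
  suc n * n choose m            ≡⟨ regroup m u (n choose m) ⟩
  suc m * (suc u * n choose m)  ∎)
  where
  open ≡-Reasoning
  n = m + u * suc m
  regroup : ∀ m u x → suc (m + u * suc m) * x ≡ suc m * (suc u * x)
  regroup = solve-∀

convolve-∣ : ∀ {d} f g k → (∀ i → i ≤ k → d ∣ f i) → d ∣ convolve f g k
convolve-∣ f g zero    d∣f = ∣m⇒∣m*n (g 0) (d∣f 0 z≤n)
convolve-∣ f g (suc k) d∣f = ∣m∣n⇒∣m+n (∣m⇒∣m*n (g (suc k)) (d∣f 0 z≤n))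
  (convolve-∣ (f ∘ suc) g k (λ i i≤k → d∣f (suc i) (s≤s i≤k)))

⊆-replicate : ∀ {A : Set} {x : A} {n T} → T ⊆ replicate n x → T ≡ replicate (length T) x
⊆-replicate {n = zero}  []          = refl
⊆-replicate {n = suc n} (_ ∷ʳ T⊆)   = ⊆-replicate T⊆
⊆-replicate {n = suc n} (refl ∷ T⊆) = cong (_ ∷_) (⊆-replicate T⊆)

esym-replicate-1 : ∀ m k → esym m (replicate k 1) ≡ k choose m
esym-replicate-1 zero    k       = refl
esym-replicate-1 (suc m) zero    = refl
esym-replicate-1 (suc m) (suc k)
  rewrite esym-replicate-1 m k | esym-replicate-1 (suc m) k = cong (_+ k choose suc m) (+-identityʳ (k choose m))

esym-short : ∀ m xs → length xs < m → esym m xs ≡ 0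
esym-short (suc m) []       _         = refl
esym-short (suc m) (x ∷ xs) (s≤s |xs|<m)
  rewrite esym-short m xs |xs|<m | esym-short (suc m) xs (m<n⇒m<1+n |xs|<m) = cong (_+ 0) (*-zeroʳ x)

-- Degree of binomial coefficients of elementary symmetric polynomials

DegreeBelow-convolve : ∀ {A : Set} n k (f g : ℕ → List A → ℕ) →
  (∀ i → i ≤ k → DegreeBelow n (λ T → + (f i T * g (k ∸ i) T))) →
  DegreeBelow n (λ T → + convolve (λ i → f i T) (λ i → g i T) k)
DegreeBelow-convolve n zero    f g dTerm = dTerm 0 z≤n
DegreeBelow-convolve n (suc k) f g dTerm =
  DegreeBelow-cong (λ T → sym (pos-+ (f 0 T * g (suc k) T) (convolve (λ i → f (suc i) T) (λ i → g i T) k)))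
    (DegreeBelow-+ (dTerm 0 z≤n) (DegreeBelow-convolve n k (f ∘ suc) g (λ i i≤k → dTerm (suc i) (s≤s i≤k))))

-- The o-th term of the Vandermonde expansion of Δ C(c e_(m+1) + d, j + 1) has weight
-- m (o + 1) + (m + 1) (j - o).
weight-drop : ∀ m {o j} → o ≤ j → suc (m * suc o + suc m * (j ∸ o)) ≤ suc m * suc j
weight-drop m {o} {j} o≤j = begin
  suc (m * suc o + suc m * (j ∸ o))      ≤⟨ m≤m+n _ o ⟩
  suc (m * suc o + suc m * (j ∸ o)) + o  ≡⟨ expand m o (j ∸ o) ⟩
  suc m * suc (o + (j ∸ o))              ≡⟨ cong (λ k → suc m * suc k) (m+[n∸m]≡n o≤j) ⟩
  suc m * suc j                          ∎
  where
  open ≤-Reasoning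
  expand : ∀ m o t → suc (m * suc o + suc m * t) + o ≡ suc m * suc (o + t)
  expand = solve-∀

Δ-choose-esym : ∀ a m j c d T →
  Δ a (λ T → + ((c * esym (suc m) T + d) choose suc j)) T ≡
  + convolve (λ o → (c * a * esym m T + 0) choose suc o) (λ o → (c * esym (suc m) T + d) choose o) j
Δ-choose-esym a m j c d T = begin
  + ((c * (a * esym m T + esym (suc m) T) + d) choose suc j) ℤ.- + (y choose suc j)
    ≡⟨ cong (λ n → + (n choose suc j) ℤ.- + (y choose suc j)) (split c a (esym m T) (esym (suc m) T) d) ⟩
  + ((x + y) choose suc j) ℤ.- + (y choose suc j)
    ≡⟨ cong (λ n → + n ℤ.- + (y choose suc j)) (vandermonde x y (suc j)) ⟩
  + (1 * y choose suc j + r) ℤ.- + (y choose suc j)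
    ≡⟨ cong (λ n → + (n + r) ℤ.- + (y choose suc j)) (*-identityˡ (y choose suc j)) ⟩
  + (y choose suc j + r) ℤ.- + (y choose suc j)
    ≡⟨ cong (ℤ._- + (y choose suc j)) (pos-+ (y choose suc j) r) ⟩
  (+ (y choose suc j) ℤ.+ + r) ℤ.- + (y choose suc j)
    ≡⟨ cancel (+ (y choose suc j)) (+ r) ⟩
  + r ∎
  where
  open ≡-Reasoning
  x = c * a * esym m T + 0
  y = c * esym (suc m) T + d
  r = convolve (λ o → x choose suc o) (y choose_) j
  split : ∀ c a e′ e d → c * (a * e′ + e) + d ≡ (c * a * e′ + 0) + (c * e + d)
  split = solve-∀
  cancel : ∀ u v → (u ℤ.+ v) ℤ.- u ≡ v
  cancel = ℤ.solve-∀

DegreeBelow-choose-esym : ∀ m j c d → DegreeBelow (suc (m * j)) (λ T → + ((c * esym m T + d) choose j))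
DegreeBelow-choose-esym m j = go m j j ≤-refl
  where
  -- b bounds j, which makes the recursive call at j ∸ o structural.
  go : ∀ m b j → j ≤ b → ∀ c d → DegreeBelow (suc (m * j)) (λ T → + ((c * esym m T + d) choose j))
  go zero    b       j       _         c d = DegreeBelow-const (+ ((c * 1 + d) choose j))
  go (suc m) b       zero    _         c d = DegreeBelow-mono (s≤s z≤n) (DegreeBelow-const (+ 1))
  go (suc m) (suc b) (suc j) (s≤s j≤b) c d = differences λ a →
    DegreeBelow-cong (λ T → sym (Δ-choose-esym a m j c d T))
      (DegreeBelow-convolve (suc m * suc j) j
        (λ o T → (c * a * esym m T + 0) choose suc o) (λ o T → (c * esym (suc m) T + d) choose o)
        (λ o o≤j → DegreeBelow-cong
          (λ T → sym (pos-* ((c * a * esym m T + 0) choose suc o) ((c * esym (suc m) T + d) choose (j ∸ o))))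
          (DegreeBelow-mono (weight-drop m o≤j)
            (DegreeBelow-*
              (go m (suc o) (suc o) ≤-refl (c * a) 0)
              (go (suc m) b (j ∸ o) (≤-trans (m∸n≤m j o) j≤b) c d)))))

⟦_<_⟧ : ℕ → ℕ → ℤ
⟦ _     < zero  ⟧ = 0ℤ
⟦ zero  < suc m ⟧ = 1ℤ
⟦ suc l < suc m ⟧ = ⟦ l < m ⟧

⟦<⟧≡1 : ∀ {l m} → l < m → ⟦ l < m ⟧ ≡ 1ℤ
⟦<⟧≡1 {zero}  {suc m} _         = refl
⟦<⟧≡1 {suc l} {suc m} (s≤s l<m) = ⟦<⟧≡1 l<m

⟦<⟧≡0 : ∀ {l m} → m ≤ l → ⟦ l < m ⟧ ≡ 0ℤ
⟦<⟧≡0 {l}     {zero}  _         = refl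
⟦<⟧≡0 {suc l} {suc m} (s≤s m≤l) = ⟦<⟧≡0 m≤l

altSum-below : ∀ {A : Set} (a : A) S m →
  altSum (a ∷ S) (λ T → ⟦ length T < suc m ⟧) ≡ -1ℤ ℤ.^ m ℤ.* + (length S choose m)
altSum-below a []      zero    = refl
altSum-below a []      (suc m) = sym (ℤ.*-zeroʳ (-1ℤ ℤ.^ suc m))
altSum-below a (b ∷ S) zero    rewrite altSum-below b S zero | altSum-0 S = refl
altSum-below a (b ∷ S) (suc m) rewrite altSum-below b S (suc m) | altSum-below b S m = begin
  -1ℤ ℤ.* g ℤ.* + (length S choose suc m) ℤ.- g ℤ.* + (length S choose m)
    ≡⟨ collect g (+ (length S choose suc m)) (+ (length S choose m)) ⟩
  -1ℤ ℤ.* g ℤ.* (+ (length S choose m) ℤ.+ + (length S choose suc m))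
    ≡⟨ cong (-1ℤ ℤ.* g ℤ.*_) (pos-+ (length S choose m) (length S choose suc m)) ⟨
  -1ℤ ℤ.* g ℤ.* + (length S choose m + length S choose suc m) ∎
  where
  open ≡-Reasoning
  g = -1ℤ ℤ.^ m
  collect : ∀ g x y → -1ℤ ℤ.* g ℤ.* x ℤ.- g ℤ.* y ≡ -1ℤ ℤ.* g ℤ.* (y ℤ.+ x)
  collect = ℤ.solve-∀

∣-1ᵐ*x⇒∣x : ∀ m {d x} → d ℤ.∣ -1ℤ ℤ.^ m ℤ.* x → d ℤ.∣ x
∣-1ᵐ*x⇒∣x zero    {d} {x} d∣ = subst (d ℤ.∣_) (ℤ.*-identityˡ x) d∣
∣-1ᵐ*x⇒∣x (suc m) {d} {x} d∣ =
  ∣-1ᵐ*x⇒∣x m (subst (d ℤ.∣_) (ℤ.neg-involutive _) (ℤ.∣m⇒∣-m (subst (d ℤ.∣_) negate d∣)))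
  where
  negate : -1ℤ ℤ.* -1ℤ ℤ.^ m ℤ.* x ≡ ℤ.- (-1ℤ ℤ.^ m ℤ.* x)
  negate = trans (ℤ.*-assoc -1ℤ (-1ℤ ℤ.^ m) x) (ℤ.-1*i≡-i (-1ℤ ℤ.^ m ℤ.* x))

-- Binomial coefficients modulo powers of p

module _ {p : ℕ} (p-prime : Prime p) where

  private instance
    p≢0 : NonZero p
    p≢0 = prime⇒nonZero p-prime

  1<p : 1 < p
  1<p = nonTrivial⇒n>1 p {{prime⇒nonTrivial p-prime}}

  pred-pᵗ : ∀ t → ∃[ m ] (suc m ≡ p ^ t)
  pred-pᵗ t = p ^ t ∸ 1 , m+[n∸m]≡n (m^n>0 p t)

  pᵗ∣a*c∧p∤c⇒pᵗ∣a : ∀ t a c → p ^ t ∣ a * c → ¬ p ∣ c → p ^ t ∣ a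
  pᵗ∣a*c∧p∤c⇒pᵗ∣a zero    a c _      _   = 1∣ a
  pᵗ∣a*c∧p∤c⇒pᵗ∣a (suc t) a c pᵗ⁺¹∣ac p∤c
    with euclidsLemma a c p-prime (∣-trans (m∣m*n (p ^ t)) pᵗ⁺¹∣ac)
  ... | inj₂ p∣c = contradiction p∣c p∤c
  ... | inj₁ (divides b refl) =
    subst (p ^ suc t ∣_) (*-comm p b) (*-monoʳ-∣ p (pᵗ∣a*c∧p∤c⇒pᵗ∣a t b c pᵗ∣bc p∤c))
    where
    pᵗ∣bc : p ^ t ∣ b * c
    pᵗ∣bc = *-cancelˡ-∣ p
      (subst (p ^ suc t ∣_) (trans (cong (_* c) (*-comm b p)) (*-assoc p b c)) pᵗ⁺¹∣ac)

  p∣pᵗCi : ∀ t i → 0 < i → i < p ^ t → p ∣ p ^ t choose i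
  p∣pᵗCi t (suc k) _ k<pᵗ with p ∣? p ^ t choose suc k
  ... | yes p∣ = p∣
  ... | no  p∤ =
    contradiction (∣⇒≤ (pᵗ∣a*c∧p∤c⇒pᵗ∣a t (suc k) _ (n∣[1+k]*nC[1+k] (p ^ t) k) p∤)) (<⇒≱ k<pᵗ)

  choose-+pᵗ : ∀ t x k → k < p ^ t → (x + p ^ t) choose k % p ≡ x choose k % p
  choose-+pᵗ t x zero    _    = refl
  choose-+pᵗ t x (suc k) k<pᵗ = begin
    (x + p ^ t) choose suc k % p
      ≡⟨ cong (λ n → n choose suc k % p) (+-comm x (p ^ t)) ⟩
    (p ^ t + x) choose suc k % p
      ≡⟨ cong (_% p) (vandermonde (p ^ t) x (suc k)) ⟩
    (1 * x choose suc k + tail) % p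
      ≡⟨ cong (λ n → (n + tail) % p) (*-identityˡ _) ⟩
    (x choose suc k + tail) % p
      ≡⟨ cong (λ n → (x choose suc k + n) % p) (m∣n⇒n≡quotient*m p∣tail) ⟩
    (x choose suc k + quotient p∣tail * p) % p
      ≡⟨ [m+kn]%n≡m%n _ (quotient p∣tail) p ⟩
    x choose suc k % p ∎
    where
    open ≡-Reasoning
    tail = convolve (λ i → p ^ t choose suc i) (x choose_) k
    p∣tail : p ∣ tail
    p∣tail = convolve-∣ _ (x choose_) k
      (λ i i≤k → p∣pᵗCi t (suc i) (s≤s z≤n) (≤-<-trans (s≤s i≤k) k<pᵗ))

  choose-+jpᵗ : ∀ t j x k → k < p ^ t → (x + j * p ^ t) choose k % p ≡ x choose k % p
  choose-+jpᵗ t zero    x k _    = cong (λ n → n choose k % p) (+-identityʳ x)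
  choose-+jpᵗ t (suc j) x k k<pᵗ = begin
    (x + (p ^ t + j * p ^ t)) choose k % p  ≡⟨ cong (λ n → n choose k % p) (regroup x (p ^ t) (j * p ^ t)) ⟩
    (x + j * p ^ t + p ^ t) choose k % p    ≡⟨ choose-+pᵗ t (x + j * p ^ t) k k<pᵗ ⟩
    (x + j * p ^ t) choose k % p            ≡⟨ choose-+jpᵗ t j x k k<pᵗ ⟩
    x choose k % p                          ∎
    where
    open ≡-Reasoning
    regroup : ∀ a b c → a + (b + c) ≡ a + c + b
    regroup = solve-∀

  p∤[m+jpˢ]Cm : ∀ s j m → suc m ≡ p ^ s → ¬ p ∣ (m + j * p ^ s) choose m
  p∤[m+jpˢ]Cm s j m 1+m≡pˢ p∣ = 0≢1+n (begin
    0                               ≡⟨ n∣m⇒m%n≡0 _ p p∣ ⟨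
    (m + j * p ^ s) choose m % p    ≡⟨ choose-+jpᵗ s j m m (≤-reflexive 1+m≡pˢ) ⟩
    m choose m % p                  ≡⟨ cong (_% p) (nCn≡1 m) ⟩
    1 % p                           ≡⟨ m<n⇒m%n≡m (1<p) ⟩
    1                               ∎)
    where open ≡-Reasoning

  p∣[e+K]CK : ∀ r K e → suc K ≡ p ^ r → ¬ p ^ r ∣ e → p ∣ (e + K) choose K
  p∣[e+K]CK r K e 1+K≡pʳ pʳ∤e =
    m%n≡0⇒n∣m _ p (viaResidue (e % p ^ r) (m%n<n e (p ^ r)) (m≡m%n+[m/n]*n e (p ^ r))
                    (λ e%pʳ≡0 → pʳ∤e (m%n≡0⇒n∣m e (p ^ r) e%pʳ≡0)))
    where
    instance
      pʳ≢0 : NonZero (p ^ r)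
      pʳ≢0 = m^n≢0 p r
    q = e / p ^ r
    K<pʳ : K < p ^ r
    K<pʳ = ≤-reflexive 1+K≡pʳ
    viaResidue : ∀ c → c < p ^ r → e ≡ c + q * p ^ r → c ≢ 0 → (e + K) choose K % p ≡ 0
    viaResidue zero    _     _  c≢0 = contradiction refl c≢0
    viaResidue (suc c) c<pʳ e≡ _   = begin
      (e + K) choose K % p
        ≡⟨ cong (λ n → n choose K % p) (trans (cong (_+ K) e≡) (regroup (suc c) (q * p ^ r) K)) ⟩
      (suc c + K + q * p ^ r) choose K % p
        ≡⟨ choose-+jpᵗ r q (suc c + K) K K<pʳ ⟩
      (suc c + K) choose K % p
        ≡⟨ cong (λ n → n choose K % p) (trans (sym (+-suc c K)) (cong (λ n → c + n) 1+K≡pʳ)) ⟩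
      (c + p ^ r) choose K % p
        ≡⟨ choose-+pᵗ r c K K<pʳ ⟩
      c choose K % p
        ≡⟨ cong (_% p) (n<k⇒nCk≡0 (≤-pred (subst (suc c <_) (sym 1+K≡pʳ) c<pʳ))) ⟩
      0 % p
        ≡⟨ n∣m⇒m%n≡0 0 p (p ∣0) ⟩
      0 ∎
      where
      open ≡-Reasoning
      regroup : ∀ a b c → a + b + c ≡ a + c + b
      regroup = solve-∀

  p-adic-split : ∀ n → .{{NonZero n}} → ∃[ t ] ∃[ m ] (n ≡ p ^ t * m × ¬ p ∣ m)
  p-adic-split n = split n (<-wellFounded n)
    where
    split : ∀ n → .{{NonZero n}} → Acc _<_ n → ∃[ t ] ∃[ m ] (n ≡ p ^ t * m × ¬ p ∣ m)
    split n (acc rec) with p ∣? n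
    ... | no  p∤n = 0 , n , sym (+-identityʳ n) , p∤n
    ... | yes (divides m@(suc _) refl)
      with split m (rec (m<m*n m p (1<p)))
    ...   | t , m′ , m≡ , p∤m′ =
      suc t , m′ , trans (cong (_* p) m≡) (rotate (p ^ t) m′ p) , p∤m′
      where
      rotate : ∀ a b c → a * b * c ≡ c * a * b
      rotate = solve-∀

  pʳ∣-transfer : ∀ r t {x y a b} → x * (p ^ t * a) ≡ y * (p ^ t * b) → ¬ p ∣ b →
    p ^ r ∣ x → p ^ r ∣ y
  pʳ∣-transfer r t {x} {y} {a} {b} eq p∤b pʳ∣x =
    pᵗ∣a*c∧p∤c⇒pᵗ∣a r y b (subst (p ^ r ∣_) xa≡yb (∣m⇒∣m*n a pʳ∣x)) p∤b
    where
    instance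
      pᵗ≢0 : NonZero (p ^ t)
      pᵗ≢0 = m^n≢0 p t
    swap : ∀ x q a → x * (q * a) ≡ q * (x * a)
    swap = solve-∀
    xa≡yb : x * a ≡ y * b
    xa≡yb = *-cancelˡ-≡ _ _ (p ^ t) (trans (sym (swap x (p ^ t) a)) (trans eq (swap y (p ^ t) b)))

  -- With y + 1 = u p^s + (i + 1) and i + 1 < p^s, both y + 1 and p^s + y + 1 have
  -- p-adic valuation v_p(i + 1).
  shared-p-power : ∀ s u i → suc i < p ^ s → ∃[ t ] ∃[ A ] ∃[ B ]
    (suc (u * p ^ s + i) ≡ p ^ t * A × suc (p ^ s + (u * p ^ s + i)) ≡ p ^ t * B × ¬ p ∣ B)
  shared-p-power s u i 1+i<pˢ with p-adic-split (suc i)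
  ... | t , i′ , 1+i≡ , p∤i′ with m≤n⇒∃[o]m+o≡n t<s
    where
    t<s : t < s
    t<s = ≰⇒> λ s≤t → <⇒≱ 1+i<pˢ
      (≤-trans (^-monoʳ-≤ p s≤t) (∣⇒≤ (subst (p ^ t ∣_) (sym 1+i≡) (m∣m*n i′))))
  ... | d , 1+t+d≡s = t , u * Q + i′ , Q + u * Q + i′ , 1+y≡ , 1+M+y≡ , p∤B
    where
    open ≡-Reasoning
    M = p ^ s
    Q = p * p ^ d
    M≡ : M ≡ p ^ t * Q
    M≡ = begin
      p ^ s                  ≡⟨ cong (p ^_) 1+t+d≡s ⟨
      p ^ (suc t + d)        ≡⟨ ^-distribˡ-+-* p (suc t) d ⟩
      p * p ^ t * p ^ d      ≡⟨ regroup p (p ^ t) (p ^ d) ⟩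
      p ^ t * Q              ∎
      where
      regroup : ∀ p a b → p * a * b ≡ a * (p * b)
      regroup = solve-∀
    1+y≡ : suc (u * M + i) ≡ p ^ t * (u * Q + i′)
    1+y≡ = begin
      suc (u * M + i)                 ≡⟨ +-suc (u * M) i ⟨
      u * M + suc i                   ≡⟨ cong₂ (λ m j → u * m + j) M≡ 1+i≡ ⟩
      u * (p ^ t * Q) + p ^ t * i′    ≡⟨ factor u (p ^ t) Q i′ ⟩
      p ^ t * (u * Q + i′)            ∎
      where
      factor : ∀ u a q i → u * (a * q) + a * i ≡ a * (u * q + i)
      factor = solve-∀
    1+M+y≡ : suc (M + (u * M + i)) ≡ p ^ t * (Q + u * Q + i′)
    1+M+y≡ = begin
      suc (M + (u * M + i))                      ≡⟨ regroup M u i ⟩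
      M + u * M + suc i                          ≡⟨ cong₂ (λ m j → m + u * m + j) M≡ 1+i≡ ⟩
      p ^ t * Q + u * (p ^ t * Q) + p ^ t * i′   ≡⟨ factor u (p ^ t) Q i′ ⟩
      p ^ t * (Q + u * Q + i′)                   ∎
      where
      regroup : ∀ m u i → suc (m + (u * m + i)) ≡ m + u * m + suc i
      regroup = solve-∀
      factor : ∀ u a q i → a * q + u * (a * q) + a * i ≡ a * (q + u * q + i)
      factor = solve-∀
    p∤B : ¬ p ∣ Q + u * Q + i′
    p∤B p∣B = p∤i′ (∣m+n∣m⇒∣n p∣B (divides (p ^ d * suc u) (factor p (p ^ d) u)))
      where
      factor : ∀ p q u → p * q + u * (p * q) ≡ q * suc u * p
      factor = solve-∀

  pʳ∣C-descend : ∀ r s u i → suc i < p ^ s →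
    p ^ r ∣ (p ^ s + (u * p ^ s + suc i)) choose p ^ s →
    p ^ r ∣ (p ^ s + (u * p ^ s + i)) choose p ^ s
  pʳ∣C-descend r s u i 1+i<pˢ pʳ∣ with shared-p-power s u i 1+i<pˢ
  ... | t , A , B , 1+y≡ , 1+M+y≡ , p∤B = pʳ∣-transfer r t ratio p∤B pʳ∣C[1+M+y]
    where
    M = p ^ s
    y = u * M + i
    ratio : suc (M + y) choose M * (p ^ t * A) ≡ (M + y) choose M * (p ^ t * B)
    ratio = subst₂ (λ a b → suc (M + y) choose M * a ≡ (M + y) choose M * b) 1+y≡ 1+M+y≡
      (choose-succ-ratio M y)
    pʳ∣C[1+M+y] : p ^ r ∣ suc (M + y) choose M
    pʳ∣C[1+M+y] = subst (λ n → p ^ r ∣ n choose M)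
      (trans (cong (λ n → M + n) (+-suc (u * M) i)) (+-suc M y)) pʳ∣

  pʳ∤[pˢ+upˢ]Cpˢ : ∀ r s u → suc u < p ^ r → ¬ p ^ r ∣ (p ^ s + u * p ^ s) choose p ^ s
  pʳ∤[pˢ+upˢ]Cpˢ r s u 1+u<pʳ pʳ∣ with pred-pᵗ s
  ... | m , 1+m≡pˢ = <⇒≱ 1+u<pʳ (∣⇒≤ (pᵗ∣a*c∧p∤c⇒pᵗ∣a r (suc u) _ pʳ∣[1+u]*C p∤C))
    where
    pʳ∣[1+u]*C : p ^ r ∣ suc u * (m + u * p ^ s) choose m
    pʳ∣[1+u]*C = subst (λ M → p ^ r ∣ suc u * (m + u * M) choose m) 1+m≡pˢ
      (subst (p ^ r ∣_) ([M+uM]CM≡[1+u]*[m+uM]Cm m u)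
        (subst (λ M → p ^ r ∣ (M + u * M) choose M) (sym 1+m≡pˢ) pʳ∣))
    p∤C : ¬ p ∣ (m + u * p ^ s) choose m
    p∤C = p∤[m+jpˢ]Cm s u m 1+m≡pˢ

  pʳ∤[pˢ+upˢ+w]Cpˢ : ∀ r s u w → w < p ^ s → suc u < p ^ r →
    ¬ p ^ r ∣ (p ^ s + (u * p ^ s + w)) choose p ^ s
  pʳ∤[pˢ+upˢ+w]Cpˢ r s u zero    _     1+u<pʳ pʳ∣ = pʳ∤[pˢ+upˢ]Cpˢ r s u 1+u<pʳ
    (subst (λ n → p ^ r ∣ (p ^ s + n) choose p ^ s) (+-identityʳ (u * p ^ s)) pʳ∣)
  pʳ∤[pˢ+upˢ+w]Cpˢ r s u (suc w) 1+w<pˢ 1+u<pʳ pʳ∣ =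
    pʳ∤[pˢ+upˢ+w]Cpˢ r s u w (<-trans (n<1+n w) 1+w<pˢ) 1+u<pʳ (pʳ∣C-descend r s u w 1+w<pˢ pʳ∣)

  pʳ∤kCpˢ : ∀ r s k → p ^ s ≤ k → k < p ^ (r + s) → ¬ p ^ r ∣ k choose p ^ s
  pʳ∤kCpˢ r s k pˢ≤k k<pʳ⁺ˢ =
    viaQuotient (k % p ^ s) (k / p ^ s) (m%n<n k (p ^ s)) (m≡m%n+[m/n]*n k (p ^ s))
    where
    instance
      pˢ≢0 : NonZero (p ^ s)
      pˢ≢0 = m^n≢0 p s
    viaQuotient : ∀ w v → w < p ^ s → k ≡ w + v * p ^ s → ¬ p ^ r ∣ k choose p ^ s
    viaQuotient w zero    w<pˢ k≡ _  = <⇒≱ w<pˢ (subst (p ^ s ≤_) (trans k≡ (+-identityʳ w)) pˢ≤k)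
    viaQuotient w (suc u) w<pˢ k≡ pʳ∣ = pʳ∤[pˢ+upˢ+w]Cpˢ r s u w w<pˢ 1+u<pʳ
      (subst (λ n → p ^ r ∣ n choose p ^ s) (trans k≡ (regroup w u (p ^ s))) pʳ∣)
      where
      regroup : ∀ w u M → w + suc u * M ≡ M + (u * M + w)
      regroup = solve-∀
      1+u<pʳ : suc u < p ^ r
      1+u<pʳ = *-cancelʳ-< (p ^ s) (suc u) (p ^ r) (begin-strict
        suc u * p ^ s       ≤⟨ m≤n+m _ w ⟩
        w + suc u * p ^ s   ≡⟨ k≡ ⟨
        k                   <⟨ k<pʳ⁺ˢ ⟩
        p ^ (r + s)         ≡⟨ ^-distribˡ-+-* p r s ⟩
        p ^ r * p ^ s       ∎)
        where open ≤-Reasoning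

  -- The upper bound

  choose-esym≡indicator-mod-p : ∀ r K M xs → suc K ≡ p ^ r → (M ≤ length xs → ¬ p ^ r ∣ esym M xs) →
    + p ℤ.∣ + ((esym M xs + K) choose K) ℤ.- ⟦ length xs < M ⟧
  choose-esym≡indicator-mod-p r K M xs 1+K≡pʳ p∤e with M ≤? length xs
  ... | no  M≰|xs| = ℤ.divides 0ℤ (begin
    + ((esym M xs + K) choose K) ℤ.- ⟦ length xs < M ⟧
      ≡⟨ cong₂ (λ e i → + ((e + K) choose K) ℤ.- i)
               (esym-short M xs (≰⇒> M≰|xs|)) (⟦<⟧≡1 (≰⇒> M≰|xs|)) ⟩
    + (K choose K) ℤ.- 1ℤ
      ≡⟨ cong (λ x → + x ℤ.- 1ℤ) (nCn≡1 K) ⟩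
    0ℤ ∎)
    where open ≡-Reasoning
  ... | yes M≤|xs| rewrite ⟦<⟧≡0 M≤|xs| | ℤ.+-identityʳ (+ ((esym M xs + K) choose K)) =
    ∣ᵤ⇒∣ (p∣[e+K]CK r K (esym M xs) 1+K≡pʳ (p∤e M≤|xs|))

  ¬zero-sum-free : ∀ r s (S : List (Fin (p ^ r))) → length S ≡ p ^ (r + s) →
    ¬ (∀ T → T ⊆ S → p ^ s ≤ length T → ¬ ZeroEm (p ^ r) (p ^ s) T)
  ¬zero-sum-free r s []      |S|≡N _    = contradiction (sym |S|≡N) (ℕ.≢-nonZero⁻¹ _ {{m^n≢0 p (r + s)}})
  ¬zero-sum-free r s (a ∷ S) |S|≡N free with pred-pᵗ r | pred-pᵗ s
  ... | K , 1+K≡pʳ | m , 1+m≡pˢ = p∤[m+jpˢ]Cm s K m 1+m≡pˢ (subst (λ n → p ∣ n choose m) |S|≡ p∣C)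
    where
    M = p ^ s
    F G : List (Fin (p ^ r)) → ℤ
    F T = + ((esym M (map toℕ T) + K) choose K)
    G T = ⟦ length T < suc m ⟧
    |S|≡ : length S ≡ m + K * M
    |S|≡ = suc-injective (begin
      suc (length S)   ≡⟨ |S|≡N ⟩
      p ^ (r + s)      ≡⟨ ^-distribˡ-+-* p r s ⟩
      p ^ r * M        ≡⟨ cong (_* M) 1+K≡pʳ ⟨
      M + K * M        ≡⟨ cong (_+ K * M) 1+m≡pˢ ⟨
      suc (m + K * M)  ∎)
      where open ≡-Reasoning
    MK<|S| : suc (M * K) ≤ length (a ∷ S)
    MK<|S| = s≤s (subst₂ _≤_ (*-comm K M) (sym |S|≡) (m≤n+m (K * M) m))
    degF : DegreeBelow (length (a ∷ S)) F
    degF = DegreeBelow-mono MK<|S| (DegreeBelow-∘map toℕ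
      (DegreeBelow-cong (λ T → cong (λ x → + ((x + K) choose K)) (*-identityˡ (esym M T)))
        (DegreeBelow-choose-esym M K 1 K)))
    F≡G-mod-p : ∀ T → T ⊆ a ∷ S → + p ℤ.∣ F T ℤ.- G T
    F≡G-mod-p T T⊆ = subst (λ n → + p ℤ.∣ F T ℤ.- ⟦ n < suc m ⟧) (length-map toℕ T)
      (subst (λ M → + p ℤ.∣ F T ℤ.- ⟦ length (map toℕ T) < M ⟧) (sym 1+m≡pˢ)
        (choose-esym≡indicator-mod-p r K M (map toℕ T) 1+K≡pʳ
          (λ M≤|T| → free T T⊆ (subst (M ≤_) (length-map toℕ T) M≤|T|))))
    p∣C : p ∣ length S choose m
    p∣C = ∣⇒∣ᵤ (∣-1ᵐ*x⇒∣x m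
      (subst (+ p ℤ.∣_) (altSum-below a S m) (altSum-∣-low-degree (a ∷ S) degF F≡G-mod-p)))

  DProp-pʳ⁺ˢ : ∀ r s → DProp (p ^ r) (p ^ s) (p ^ (r + s))
  DProp-pʳ⁺ˢ r s S N≤|S|
    with sublist-any? (λ T → (p ^ s ≤? length T) ×-dec (p ^ r ∣? esym (p ^ s) (map toℕ T)))
                      (take (p ^ (r + s)) S)
  ... | yes (T , T⊆ , M≤|T| , zero-sum) = T , ⊆-trans T⊆ (take-⊆ (p ^ (r + s)) S) , M≤|T| , zero-sum
  ... | no  none = ⊥-elim (¬zero-sum-free r s (take (p ^ (r + s)) S)
          (trans (length-take (p ^ (r + s)) S) (m≤n⇒m⊓n≡m N≤|S|))
          (λ T T⊆ M≤|T| zero-sum → none (T , T⊆ , M≤|T| , zero-sum)))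

  -- The lower bound

  -- In ℤ_1 = Fin 1 the only element is 0 = 1.
  one : ∀ r → Fin (p ^ r)
  one zero    = Fin.zero
  one (suc r) = fromℕ< 1<pʳ⁺¹
    where
    1<pʳ⁺¹ : 1 < p ^ suc r
    1<pʳ⁺¹ = ≤-trans (1<p) (m≤m*n p (p ^ r) {{m^n≢0 p r}})

  ones-zero-sum-free : ∀ r s {L T} → T ⊆ replicate L (one r) → p ^ s ≤ length T → length T < p ^ (r + s) →
    ¬ ZeroEm (p ^ r) (p ^ s) T
  ones-zero-sum-free zero    s _  pˢ≤|T| |T|<pˢ _ = <⇒≱ |T|<pˢ pˢ≤|T|
  ones-zero-sum-free (suc r) s {L} {T} T⊆ pˢ≤|T| |T|<N pʳ∣e =
    pʳ∤kCpˢ (suc r) s (length T) pˢ≤|T| |T|<N (subst (p ^ suc r ∣_) e≡C pʳ∣e)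
    where
    e≡C : esym (p ^ s) (map toℕ T) ≡ length T choose p ^ s
    e≡C = begin
      esym (p ^ s) (map toℕ T)
        ≡⟨ cong (esym (p ^ s) ∘ map toℕ) (⊆-replicate T⊆) ⟩
      esym (p ^ s) (map toℕ (replicate (length T) (one (suc r))))
        ≡⟨ cong (esym (p ^ s)) (map-replicate toℕ (length T) _) ⟩
      esym (p ^ s) (replicate (length T) (toℕ (one (suc r))))
        ≡⟨ cong (esym (p ^ s) ∘ replicate (length T)) (toℕ-fromℕ< _) ⟩
      esym (p ^ s) (replicate (length T) 1)
        ≡⟨ esym-replicate-1 (p ^ s) (length T) ⟩
      length T choose p ^ s ∎
      where open ≡-Reasoning

  ¬DProp-<pʳ⁺ˢ : ∀ r s t → t < p ^ (r + s) → ¬ DProp (p ^ r) (p ^ s) t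
  ¬DProp-<pʳ⁺ˢ r s t t<N dprop with pred-pᵗ (r + s)
  ... | L , 1+L≡N with dprop (replicate L (one r)) (subst (t ≤_) (sym (length-replicate L)) t≤L)
    where
    t≤L : t ≤ L
    t≤L = ≤-pred (subst (t <_) (sym 1+L≡N) t<N)
  ... | T , T⊆ , pˢ≤|T| , zero-sum = ones-zero-sum-free r s T⊆ pˢ≤|T| |T|<N zero-sum
    where
    |T|<N : length T < p ^ (r + s)
    |T|<N = subst (length T <_) 1+L≡N (s≤s (subst (length T ≤_) (length-replicate L) (length-mono-≤ T⊆)))

theorem8 : (p r s : ℕ) → Prime p → IsD (p ^ r) (p ^ s) (p ^ (r + s))
theorem8 p r s p-prime =
    m^n>0 p {{prime⇒nonZero p-prime}} (r + s)
  , DProp-pʳ⁺ˢ p-prime r s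
  , λ t _ t<N → ¬DProp-<pʳ⁺ˢ p-prime r s t t<N
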